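{- Let $i,j$ be integers with $0\leq i\leq j$ and $j\geq 1$, and let $G$ be a graph on $n$ vertices such that both $G$ and its complement $\bar G$ are connected. Then \[\gamma_{i/j}(G)+\gamma_{i/j}(\bar G)\leq \left\lceil \frac{i}{j}\left(\left\lfloor \frac{n}{2}\right\rfloor+2\right)\right\rceil+1.\]
   Context: All graphs are finite and simple; $\bar G$ is the complement of $G$. For a graph $G=(V,E)$ and $v\in V$, $N[v]=\{v\}\cup\{u : uv\in E\}$, and for $S\subseteq V$, $N[S]=\bigcup_{u\in S}N[u]$. For $p\in[0,1]$, a set $S\subseteq V$ is a $p$-dominating set if $|N[S]|/|V|\geq p$; $\gamma_p(G)$ is the minimum cardinality of a $p$-dominating set of $G$. -}

module Defs where

open import Data.Nat using (ℕ; zero; suc; _+_; _*_; _∸_; _≤_; _/_; NonZero)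
open import Data.Bool using (Bool; true; false; not; _∧_)
open import Data.Fin using (Fin)
open import Data.Fin.Subset using (Subset; _∈_; ∣_∣)
open import Data.Vec using (tabulate)
open import Data.List using (List; []; _∷_)
open import Data.Product using (Σ; ∃; _×_; _,_)
open import Relation.Binary.PropositionalEquality using (_≡_)
open import Relation.Nullary using (¬_)
open import Relation.Nullary.Decidable using (⌊_⌋)
open import Data.Fin using (_≟_)

record Graph (n : ℕ) : Set where
  field
    adj   : Fin n → Fin n → Bool
    sym   : ∀ u v → adj u v ≡ adj v u
    irrefl : ∀ v → adj v v ≡ false
open Graph public

complement : ∀ {n} → Graph n → Graph n
complement {n} G = record
  { adj = λ u v → not ⌊ u ≟ v ⌋ ∧ not (adj G u v)
  ; sym = λ u v → lemma u v
  ; irrefl = λ v → irr v }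
  where
  open import Relation.Binary.PropositionalEquality using (refl; cong₂; cong)
  open import Relation.Nullary using (yes; no)
  lemma : ∀ u v → (not ⌊ u ≟ v ⌋ ∧ not (adj G u v)) ≡ (not ⌊ v ≟ u ⌋ ∧ not (adj G v u))
  lemma u v with u ≟ v | v ≟ u
  ... | yes _ | yes _ = refl
  ... | no _ | no _ = cong not (Graph.sym G u v)
  ... | yes refl | no p with p refl
  ... | ()
  lemma u v | no p | yes refl with p refl
  ... | ()
  irr : ∀ v → (not ⌊ v ≟ v ⌋ ∧ not (adj G v v)) ≡ false
  irr v with v ≟ v
  ... | yes _ = refl
  ... | no p with p refl
  ... | ()

data Walk {n : ℕ} (G : Graph n) : Fin n → Fin n → Set where
  here : ∀ {v} → Walk G v v
  step : ∀ {u w v} → adj G u w ≡ true → Walk G w v → Walk G u v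

Connected : ∀ {n} → Graph n → Set
Connected {n} G = ∀ (u v : Fin n) → Walk G u v

N[_]_ : ∀ {n} → Subset n → Graph n → Subset n
N[_]_ {n} S G = tabulate λ v → memb v S ∨' anyAdj v
  where
  open import Data.Bool using () renaming (_∨_ to _∨'_)
  open import Data.Vec using (lookup; foldr; zipWith)
  open import Data.Fin.Subset using (Side)
  memb : Fin n → Subset n → Bool
  memb v T = lookup T v
  anyAdj : Fin n → Bool
  anyAdj v = foldr (λ _ → Bool) _∨'_ false (tabulate λ u → lookup S u ∧ adj G u v)

-- S is a (i/j)-dominating set: |N[S]| / n ≥ i / j, i.e. j·|N[S]| ≥ i·n  (j ≥ 1).
IsDominating : ∀ {n} → Graph n → ℕ → ℕ → Subset n → Set
IsDominating {n} G i j S = i * n ≤ j * ∣ N[ S ] G ∣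

IsGamma : ∀ {n} → Graph n → ℕ → ℕ → ℕ → Set
IsGamma {n} G i j γ =
  (Σ (Subset n) λ S → IsDominating G i j S × ∣ S ∣ ≡ γ)
  × (∀ (S : Subset n) → IsDominating G i j S → γ ≤ ∣ S ∣)

ceilDiv : ℕ → (j : ℕ) → .{{NonZero j}} → ℕ
ceilDiv a j = (a + (j ∸ 1)) / j

module Submission where

-- If D dominates G, then for k = ⌈i·|D|/j⌉ ≤ |D| some k vertices of D dominate at least
-- a k/|D| ≥ i/j share of all vertices: take any d ∈ D, recurse on D − d and the vertices
-- d does not dominate, and keep d exactly when it dominates more than an average share.
-- Hence γ_{i/j} ≤ ⌈i·γ/j⌉, and as ⌈x/j⌉ + ⌈y/j⌉ ≤ ⌈(x+y)/j⌉ + 1 it suffices to show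
-- γ(G) + γ(Ḡ) ≤ ⌊n/2⌋ + 2. If G or Ḡ is dominated by two vertices, the other graph has
-- no isolated vertex and Ore's bound γ ≤ ⌊n/2⌋ applies (a minimal dominating set and its
-- complement both dominate). Otherwise every two vertices have a common neighbour both in G
-- and in Ḡ; for a vertex v of degree d with r non-neighbours, v together with a common
-- G-neighbour of each pair of non-neighbours dominates G, and v together with a common
-- Ḡ-neighbour of each pair of neighbours dominates Ḡ. These have at most 2 + ⌈r/2⌉ + ⌈d/2⌉
-- vertices, which is ⌊n/2⌋ + 2 once r or d is even; as r + d = n − 1, this holds for every
-- v when n is even and, by the handshake lemma, for some v when n is odd.

open import Data.Bool using (Bool; true; false; T; _∨_)
open import Data.Bool.Properties using (T-∧; T-∨; T-≡)
open import Data.Fin using (Fin; zero; suc; _≟_)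
open import Data.Fin.Properties using (any?; all?; ¬∀⟶∃¬)
open import Data.Fin.Subset
  using (Subset; _∈_; _∉_; _⊆_; ∣_∣; ⁅_⁆; ∁; _∪_; _∩_; _-_; Nonempty; Empty)
  renaming (⊥ to ∅; ⊤ to Full)
open import Data.Fin.Subset.Properties
open import Data.Nat
  using (ℕ; zero; suc; _+_; _*_; _/_; _%_; _≤_; _<_; z≤n; s≤s; s≤s⁻¹; NonZero; >-nonZero; ⌊_/2⌋; ⌈_/2⌉; parity)
open import Data.Nat.DivMod using (m≡m%n+[m/n]*n; m%n<n; m/n*n≤m; m<n*o⇒m/o<n; m/n≡1+[m∸n]/n)
open import Data.Nat.Induction using (<-wellFounded)
open import Data.Nat.Properties hiding (_≟_)
open import Data.Nat.Tactic.RingSolver using (solve-∀)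
open import Data.Parity using (Parity; 0ℙ; 1ℙ)
import Data.Parity as ℙ
import Data.Parity.Properties as ℙ
open import Data.Product using (∃; ∃-syntax; _×_; _,_; proj₁)
open import Data.Sum using (_⊎_; inj₁; inj₂; swap)
open import Data.Vec using ([]; _∷_; tabulate; foldr)
open import Data.Vec.Properties using (lookup∘tabulate; []=⇒lookup; lookup⇒[]=)
open import Function using (_∘_; id; Equivalence)
open import Induction.WellFounded using (Acc; acc)
open import Relation.Binary.PropositionalEquality
open import Relation.Nullary using (¬_; Dec; yes; no; contradiction)
open import Relation.Nullary.Decidable using (_×-dec_)

open import Defs hiding (sym)

open import Algebra.Properties.CommutativeMonoid.Sum ℙ.+-0-commutativeMonoid
  using (sum-syntax; ∑-distrib-+; sum-cong-≗)
open import Algebra.Properties.CommutativeSemigroup *-commutativeSemigroup using (x∙yz≈y∙xz)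
open import Algebra.Properties.CommutativeSemigroup +-commutativeSemigroup
  using () renaming (interchange to +-interchange)

open Equivalence using (to; from)

private
  variable
    n : ℕ

ceilDiv-*-≤ : ∀ a j → suc j * ceilDiv a (suc j) ≤ a + j
ceilDiv-*-≤ a j = ≤-trans (≤-reflexive (*-comm (suc j) _)) (m/n*n≤m (a + j) (suc j))

≤-*-ceilDiv : ∀ a j → a ≤ suc j * ceilDiv a (suc j)
≤-*-ceilDiv a j = +-cancelʳ-≤ j a _ (begin
  a + j                                     ≡⟨ m≡m%n+[m/n]*n (a + j) (suc j) ⟩
  (a + j) % suc j + (a + j) / suc j * suc j
    ≤⟨ +-mono-≤ (s≤s⁻¹ (m%n<n (a + j) (suc j))) (≤-reflexive (*-comm _ (suc j))) ⟩
  j + suc j * ceilDiv a (suc j)             ≡⟨ +-comm j _ ⟩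
  suc j * ceilDiv a (suc j) + j             ∎)
  where open ≤-Reasoning

ceilDiv-≤ : ∀ a j c → a ≤ suc j * c → ceilDiv a (suc j) ≤ c
ceilDiv-≤ a j c a≤ = s≤s⁻¹ (m<n*o⇒m/o<n (begin-strict
  a + j             ≤⟨ +-monoˡ-≤ j a≤ ⟩
  suc j * c + j     <⟨ +-monoʳ-< (suc j * c) (n<1+n j) ⟩
  suc j * c + suc j ≡⟨ trans (+-comm _ (suc j)) (cong (suc j +_) (*-comm (suc j) c)) ⟩
  suc c * suc j     ∎))
  where open ≤-Reasoning

ceilDiv-mono-≤ : ∀ j {a b} → a ≤ b → ceilDiv a (suc j) ≤ ceilDiv b (suc j)
ceilDiv-mono-≤ j {a} {b} a≤b = ceilDiv-≤ a j _ (≤-trans a≤b (≤-*-ceilDiv b j))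

ceilDiv-+-≤ : ∀ x y j → ceilDiv x (suc j) + ceilDiv y (suc j) ≤ ceilDiv (x + y) (suc j) + 1
ceilDiv-+-≤ x y j = s≤s⁻¹ (*-cancelˡ-< (suc j) _ _ (begin-strict
  suc j * (⌈x⌉ + ⌈y⌉)           ≡⟨ *-distribˡ-+ (suc j) ⌈x⌉ ⌈y⌉ ⟩
  suc j * ⌈x⌉ + suc j * ⌈y⌉     ≤⟨ +-mono-≤ (ceilDiv-*-≤ x j) (ceilDiv-*-≤ y j) ⟩
  (x + j) + (y + j)             ≡⟨ +-interchange x j y j ⟩
  (x + y) + (j + j)             ≤⟨ +-monoˡ-≤ (j + j) (≤-*-ceilDiv (x + y) j) ⟩
  suc j * ⌈x+y⌉ + (j + j)       <⟨ +-monoʳ-< (suc j * ⌈x+y⌉) (+-mono-< (n<1+n j) (n<1+n j)) ⟩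
  suc j * ⌈x+y⌉ + (suc j + suc j) ≡⟨ regroup (suc j) ⌈x+y⌉ ⟩
  suc j * suc (⌈x+y⌉ + 1)       ∎))
  where
  open ≤-Reasoning
  ⌈x⌉ = ceilDiv x (suc j)
  ⌈y⌉ = ceilDiv y (suc j)
  ⌈x+y⌉ = ceilDiv (x + y) (suc j)
  regroup : ∀ s c → s * c + (s + s) ≡ s * suc (c + 1)
  regroup = solve-∀

⌊n/2⌋≡n/2 : ∀ n → ⌊ n /2⌋ ≡ n / 2
⌊n/2⌋≡n/2 zero = refl
⌊n/2⌋≡n/2 (suc zero) = refl
⌊n/2⌋≡n/2 (suc (suc n)) =
  trans (cong suc (⌊n/2⌋≡n/2 n)) (sym (m/n≡1+[m∸n]/n {suc (suc n)} {2} (s≤s (s≤s z≤n))))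

m+n≡o⇒m≤⌊o/2⌋⊎n≤⌊o/2⌋ : ∀ {m n o} → m + n ≡ o → m ≤ ⌊ o /2⌋ ⊎ n ≤ ⌊ o /2⌋
m+n≡o⇒m≤⌊o/2⌋⊎n≤⌊o/2⌋ {m} {n} refl with ≤-total m n
... | inj₁ m≤n = inj₁ (≤-trans (≤-reflexive (n≡⌊n+n/2⌋ m)) (⌊n/2⌋-mono (+-monoʳ-≤ m m≤n)))
... | inj₂ n≤m = inj₂ (≤-trans (≤-reflexive (n≡⌊n+n/2⌋ n)) (⌊n/2⌋-mono (+-monoˡ-≤ n n≤m)))

⌈m/2⌉+⌈n/2⌉≡⌈m+n/2⌉ : ∀ m n → parity m ≡ 0ℙ ⊎ parity n ≡ 0ℙ → ⌈ m /2⌉ + ⌈ n /2⌉ ≡ ⌈ m + n /2⌉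
⌈m/2⌉+⌈n/2⌉≡⌈m+n/2⌉ m n (inj₁ m-even) = evenˡ m n m-even
  where
  evenˡ : ∀ m n → parity m ≡ 0ℙ → ⌈ m /2⌉ + ⌈ n /2⌉ ≡ ⌈ m + n /2⌉
  evenˡ zero n _ = refl
  evenˡ (suc (suc m)) n even = cong suc (evenˡ m n even)
⌈m/2⌉+⌈n/2⌉≡⌈m+n/2⌉ m n (inj₂ n-even) = begin
  ⌈ m /2⌉ + ⌈ n /2⌉ ≡⟨ +-comm ⌈ m /2⌉ _ ⟩
  ⌈ n /2⌉ + ⌈ m /2⌉ ≡⟨ ⌈m/2⌉+⌈n/2⌉≡⌈m+n/2⌉ n m (inj₁ n-even) ⟩
  ⌈ n + m /2⌉       ≡⟨ cong ⌈_/2⌉ (+-comm n m) ⟩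
  ⌈ m + n /2⌉       ∎
  where open ≡-Reasoning

∣p∪q∣+∣p∩q∣≡∣p∣+∣q∣ : ∀ (p q : Subset n) → ∣ p ∪ q ∣ + ∣ p ∩ q ∣ ≡ ∣ p ∣ + ∣ q ∣
∣p∪q∣+∣p∩q∣≡∣p∣+∣q∣ [] [] = refl
∣p∪q∣+∣p∩q∣≡∣p∣+∣q∣ (true ∷ p) (true ∷ q) =
  cong suc (trans (+-suc _ _) (trans (cong suc (∣p∪q∣+∣p∩q∣≡∣p∣+∣q∣ p q)) (sym (+-suc _ _))))
∣p∪q∣+∣p∩q∣≡∣p∣+∣q∣ (true ∷ p) (false ∷ q) = cong suc (∣p∪q∣+∣p∩q∣≡∣p∣+∣q∣ p q)
∣p∪q∣+∣p∩q∣≡∣p∣+∣q∣ (false ∷ p) (true ∷ q) =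
  trans (cong suc (∣p∪q∣+∣p∩q∣≡∣p∣+∣q∣ p q)) (sym (+-suc _ _))
∣p∪q∣+∣p∩q∣≡∣p∣+∣q∣ (false ∷ p) (false ∷ q) = ∣p∪q∣+∣p∩q∣≡∣p∣+∣q∣ p q

∣p∪q∣≤∣p∣+∣q∣ : ∀ (p q : Subset n) → ∣ p ∪ q ∣ ≤ ∣ p ∣ + ∣ q ∣
∣p∪q∣≤∣p∣+∣q∣ p q = ≤-trans (m≤m+n _ _) (≤-reflexive (∣p∪q∣+∣p∩q∣≡∣p∣+∣q∣ p q))

∣⁅x⁆∪p∣≤1+∣p∣ : ∀ x (p : Subset n) → ∣ ⁅ x ⁆ ∪ p ∣ ≤ suc ∣ p ∣
∣⁅x⁆∪p∣≤1+∣p∣ x p = ≤-trans (∣p∪q∣≤∣p∣+∣q∣ ⁅ x ⁆ p) (≤-reflexive (cong (_+ ∣ p ∣) (∣⁅x⁆∣≡1 x)))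

∣∅∣≤m : ∀ m → ∣ ∅ {n} ∣ ≤ m
∣∅∣≤m {n} m = ≤-trans (≤-reflexive (∣⊥∣≡0 n)) z≤n

∣p∣≡∣p∩q∣+∣p∩∁q∣ : ∀ (p q : Subset n) → ∣ p ∣ ≡ ∣ p ∩ q ∣ + ∣ p ∩ ∁ q ∣
∣p∣≡∣p∩q∣+∣p∩∁q∣ [] [] = refl
∣p∣≡∣p∩q∣+∣p∩∁q∣ (true ∷ p) (true ∷ q) = cong suc (∣p∣≡∣p∩q∣+∣p∩∁q∣ p q)
∣p∣≡∣p∩q∣+∣p∩∁q∣ (true ∷ p) (false ∷ q) = trans (cong suc (∣p∣≡∣p∩q∣+∣p∩∁q∣ p q)) (sym (+-suc _ _))
∣p∣≡∣p∩q∣+∣p∩∁q∣ (false ∷ p) (_ ∷ q) = ∣p∣≡∣p∩q∣+∣p∩∁q∣ p q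

∣p∣+∣∁p∣≡n : ∀ (p : Subset n) → ∣ p ∣ + ∣ ∁ p ∣ ≡ n
∣p∣+∣∁p∣≡n p = trans (cong (∣ p ∣ +_) (∣∁p∣≡n∸∣p∣ p)) (m+[n∸m]≡n (∣p∣≤n p))

Empty⇒∣p∣≡0 : {p : Subset n} → Empty p → ∣ p ∣ ≡ 0
Empty⇒∣p∣≡0 {n} e = trans (cong ∣_∣ (Empty-unique e)) (∣⊥∣≡0 n)

x∈p⇒0<∣p∣ : ∀ {x} {p : Subset n} → x ∈ p → 0 < ∣ p ∣
x∈p⇒0<∣p∣ x∈p = ≤-<-trans z≤n (x∈p⇒∣p-x∣<∣p∣ x∈p)

0<∣p∣⇒Nonempty : (p : Subset n) → 0 < ∣ p ∣ → Nonempty p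
0<∣p∣⇒Nonempty p 0<∣p∣ with nonempty? p
... | yes ne = ne
... | no e = contradiction (Empty⇒∣p∣≡0 e) (>⇒≢ 0<∣p∣)

∣p∣+∣q∣≤∣r∣ : ∀ {p q r s : Subset n} → p ⊆ r ∩ s → q ⊆ r ∩ ∁ s → ∣ p ∣ + ∣ q ∣ ≤ ∣ r ∣
∣p∣+∣q∣≤∣r∣ {r = r} {s} p⊆ q⊆ =
  ≤-trans (+-mono-≤ (p⊆q⇒∣p∣≤∣q∣ p⊆) (p⊆q⇒∣p∣≤∣q∣ q⊆)) (≤-reflexive (sym (∣p∣≡∣p∩q∣+∣p∩∁q∣ r s)))

∩-mono-⊆ : ∀ {p q r s : Subset n} → p ⊆ q → r ⊆ s → p ∩ r ⊆ q ∩ s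
∩-mono-⊆ {p = p} {r = r} p⊆q r⊆s x∈ with x∈p∩q⁻ p r x∈
... | x∈p , x∈r = x∈p∩q⁺ (p⊆q x∈p , r⊆s x∈r)

Empty[p-x]∧y∈p⇒y≡x : ∀ {p : Subset n} {x y : Fin n} → Empty (p - x) → y ∈ p → y ≡ x
Empty[p-x]∧y∈p⇒y≡x {x = x} {y} p-x-empty y∈p with y ≟ x
... | yes y≡x = y≡x
... | no y≢x = contradiction (_ , x∈p∧x≢y⇒x∈p-y y∈p y≢x) p-x-empty

∈tabulate⁺ : ∀ (f : Fin n → Bool) {x} → T (f x) → x ∈ tabulate f
∈tabulate⁺ f {x} t = lookup⇒[]= x (tabulate f) (trans (lookup∘tabulate f x) (to T-≡ t))

∈tabulate⁻ : ∀ (f : Fin n → Bool) {x} → x ∈ tabulate f → T (f x)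
∈tabulate⁻ f {x} x∈ = from T-≡ (trans (sym (lookup∘tabulate f x)) ([]=⇒lookup x∈))

T-foldr-∨⁺ : ∀ (f : Fin n → Bool) {x} → T (f x) → T (foldr (λ _ → Bool) _∨_ false (tabulate f))
T-foldr-∨⁺ f {zero} t = from T-∨ (inj₁ t)
T-foldr-∨⁺ f {suc x} t = from T-∨ (inj₂ (T-foldr-∨⁺ (f ∘ suc) t))

T-foldr-∨⁻ : ∀ (f : Fin n → Bool) → T (foldr (λ _ → Bool) _∨_ false (tabulate f)) → ∃[ x ] T (f x)
T-foldr-∨⁻ {suc n} f t with to T-∨ t
... | inj₁ t₀ = zero , t₀
... | inj₂ t′ with T-foldr-∨⁻ (f ∘ suc) t′
...   | x , tx = suc x , tx

Adj : Graph n → Fin n → Fin n → Set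
Adj G u v = T (adj G u v)

Adj-sym : (G : Graph n) {u v : Fin n} → Adj G u v → Adj G v u
Adj-sym G {u} {v} = subst T (Graph.sym G u v)

Adj⇒≢ : (G : Graph n) {u v : Fin n} → Adj G u v → u ≢ v
Adj⇒≢ G {u} a refl = subst T (irrefl G u) a

Dominates : Graph n → Fin n → Fin n → Set
Dominates G u v = u ≡ v ⊎ Adj G u v

Dominating : Graph n → Subset n → Set
Dominating G D = ∀ v → v ∈ N[ D ] G

∈N[]⁺ : (G : Graph n) (D : Subset n) {u v : Fin n} → u ∈ D → Dominates G u v → v ∈ N[ D ] G
∈N[]⁺ G D u∈D (inj₁ refl) = ∈tabulate⁺ _ (from T-∨ (inj₁ (from T-≡ ([]=⇒lookup u∈D))))
∈N[]⁺ G D {u} u∈D (inj₂ a) =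
  ∈tabulate⁺ _ (from T-∨ (inj₂ (T-foldr-∨⁺ _ {u} (from T-∧ (from T-≡ ([]=⇒lookup u∈D) , a)))))

∈N[]⁻ : (G : Graph n) (D : Subset n) {v : Fin n} → v ∈ N[ D ] G → ∃[ u ] u ∈ D × Dominates G u v
∈N[]⁻ G D {v} v∈ with to T-∨ (∈tabulate⁻ _ v∈)
... | inj₁ t = v , lookup⇒[]= v D (to T-≡ t) , inj₁ refl
... | inj₂ t with T-foldr-∨⁻ _ t
...   | u , tu with to T-∧ tu
...     | u∈D , a = u , lookup⇒[]= u D (to T-≡ u∈D) , inj₂ a

N[]-mono : (G : Graph n) {D D′ : Subset n} → D ⊆ D′ → N[ D ] G ⊆ N[ D′ ] G
N[]-mono G {D} {D′} D⊆D′ v∈ with ∈N[]⁻ G D v∈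
... | u , u∈D , u→v = ∈N[]⁺ G D′ (D⊆D′ u∈D) u→v

Full-dominating : (G : Graph n) → Dominating G Full
Full-dominating G _ = ∈N[]⁺ G Full ∈⊤ (inj₁ refl)

dominating? : (G : Graph n) (D : Subset n) → Dec (Dominating G D)
dominating? G D = all? (λ v → v ∈? N[ D ] G)

¬Adj⇒Dominates-complement : (G : Graph n) {u v : Fin n} → ¬ Adj G u v → Dominates (complement G) u v
¬Adj⇒Dominates-complement G {u} {v} ¬uv with u ≟ v
... | yes u≡v = inj₁ u≡v
... | no _ with adj G u v
...   | true = contradiction _ ¬uv
...   | false = inj₂ _

¬Dominates⇒Adj-complement : (G : Graph n) {u v : Fin n} → ¬ Dominates G u v → Adj (complement G) u v
¬Dominates⇒Adj-complement G ¬u→v with ¬Adj⇒Dominates-complement G (¬u→v ∘ inj₂)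
... | inj₁ u≡v = contradiction (inj₁ u≡v) ¬u→v
... | inj₂ uv = uv

¬Dominates-complement⇒Adj : (G : Graph n) {u v : Fin n} → ¬ Dominates (complement G) u v → Adj G u v
¬Dominates-complement⇒Adj G {u} {v} ¬u→v with u ≟ v
... | yes u≡v = contradiction (inj₁ u≡v) ¬u→v
... | no _ with adj G u v
...   | true = _
...   | false = contradiction (inj₂ _) ¬u→v

-- Averaging over a dominating set

private
  regroupˡ : ∀ g k w t → g * (k * (w + t)) ≡ k * (g * w) + g * (k * t)
  regroupˡ = solve-∀

  regroupʳ : ∀ g c → suc g * (g * c) ≡ g * (suc g * c)
  regroupʳ = solve-∀

  expandˡ : ∀ k e w t → (k + e) * (suc k * (w + t)) ≡
                        ((k + e) * suc k * w + suc (k + e) * (k * t)) + e * t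
  expandˡ = solve-∀

  expandʳ : ∀ k e w c → (k + e) * (suc (k + e) * (w + c)) ≡
                        ((k + e) * suc k * w + suc (k + e) * ((k + e) * c)) + e * ((k + e) * w)
  expandʳ = solve-∀

-- The averaging step for a dominator covering w of w + t vertices: it is dropped when its
-- share is at most average (g·w ≤ t) and kept otherwise.

skip-≤ : ∀ {g} k w t c .{{_ : NonZero g}} → g * w ≤ t → k * t ≤ g * c → k * (w + t) ≤ suc g * c
skip-≤ {g} k w t c gw≤t kt≤gc = *-cancelˡ-≤ g (begin
  g * (k * (w + t))           ≡⟨ regroupˡ g k w t ⟩
  k * (g * w) + g * (k * t)   ≤⟨ +-monoˡ-≤ (g * (k * t)) (*-monoʳ-≤ k gw≤t) ⟩
  suc g * (k * t)             ≤⟨ *-monoʳ-≤ (suc g) kt≤gc ⟩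
  suc g * (g * c)             ≡⟨ regroupʳ g c ⟩
  g * (suc g * c)             ∎)
  where open ≤-Reasoning

take-≤ : ∀ {k g} w t c .{{_ : NonZero g}} → k ≤ g → t ≤ g * w → k * t ≤ g * c →
         suc k * (w + t) ≤ suc g * (w + c)
take-≤ {k} w t c k≤g t≤gw kt≤gc with m≤n⇒∃[o]m+o≡n k≤g
... | e , refl = *-cancelˡ-≤ (k + e) (begin
  (k + e) * (suc k * (w + t))
    ≡⟨ expandˡ k e w t ⟩
  ((k + e) * suc k * w + suc (k + e) * (k * t)) + e * t
    ≤⟨ +-mono-≤ (+-monoʳ-≤ ((k + e) * suc k * w) (*-monoʳ-≤ (suc (k + e)) kt≤gc)) (*-monoʳ-≤ e t≤gw) ⟩
  ((k + e) * suc k * w + suc (k + e) * ((k + e) * c)) + e * ((k + e) * w)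
    ≡⟨ expandʳ k e w c ⟨
  (k + e) * (suc (k + e) * (w + c))
    ∎)
  where open ≤-Reasoning

cross-≤-trans : ∀ {i m k g n c} .{{_ : NonZero g}} → i * g ≤ m * k → k * n ≤ g * c → i * n ≤ m * c
cross-≤-trans {i} {m} {k} {g} {n} {c} ig≤mk kn≤gc = *-cancelˡ-≤ g (begin
  g * (i * n)   ≡⟨ x∙yz≈y∙xz g i n ⟩
  i * (g * n)   ≡⟨ *-assoc i g n ⟨
  (i * g) * n   ≤⟨ *-monoˡ-≤ n ig≤mk ⟩
  (m * k) * n   ≡⟨ *-assoc m k n ⟩
  m * (k * n)   ≤⟨ *-monoʳ-≤ m kn≤gc ⟩
  m * (g * c)   ≡⟨ x∙yz≈y∙xz m g c ⟩
  g * (m * c)   ∎)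
  where open ≤-Reasoning

X∩∁N[⁅d⁆]⊆N[D-d] : (G : Graph n) (D : Subset n) (d : Fin n) {X : Subset n} →
  X ⊆ N[ D ] G → X ∩ ∁ (N[ ⁅ d ⁆ ] G) ⊆ N[ D - d ] G
X∩∁N[⁅d⁆]⊆N[D-d] G D d {X} X⊆N[D] x∈ with x∈p∩q⁻ X _ x∈
... | x∈X , x∉N[d] with ∈N[]⁻ G D (X⊆N[D] x∈X)
...   | u , u∈D , u→x = ∈N[]⁺ G (D - d) (x∈p∧x≢y⇒x∈p-y u∈D u≢d) u→x
  where
  u≢d : u ≢ d
  u≢d refl = x∈∁p⇒x∉p x∉N[d] (∈N[]⁺ G ⁅ d ⁆ (x∈⁅x⁆ d) u→x)

∣X∩N[d]∣+∣X-N[d]∩N[S]∣≤∣X∩N[d∪S]∣ : (G : Graph n) (X S : Subset n) (d : Fin n) →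
  ∣ X ∩ N[ ⁅ d ⁆ ] G ∣ + ∣ (X ∩ ∁ (N[ ⁅ d ⁆ ] G)) ∩ N[ S ] G ∣ ≤ ∣ X ∩ N[ ⁅ d ⁆ ∪ S ] G ∣
∣X∩N[d]∣+∣X-N[d]∩N[S]∣≤∣X∩N[d∪S]∣ G X S d = ∣p∣+∣q∣≤∣r∣ near far
  where
  N[d] = N[ ⁅ d ⁆ ] G
  near : X ∩ N[d] ⊆ (X ∩ N[ ⁅ d ⁆ ∪ S ] G) ∩ N[d]
  near x∈ with x∈p∩q⁻ X N[d] x∈
  ... | x∈X , x∈N[d] = x∈p∩q⁺ (x∈p∩q⁺ (x∈X , N[]-mono G (p⊆p∪q {p = ⁅ d ⁆} S) x∈N[d]) , x∈N[d])
  far : (X ∩ ∁ N[d]) ∩ N[ S ] G ⊆ (X ∩ N[ ⁅ d ⁆ ∪ S ] G) ∩ ∁ N[d]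
  far x∈ with x∈p∩q⁻ (X ∩ ∁ N[d]) _ x∈
  ... | x∈X∖N[d] , x∈N[S] with x∈p∩q⁻ X _ x∈X∖N[d]
  ...   | x∈X , x∉N[d] = x∈p∩q⁺ (x∈p∩q⁺ (x∈X , N[]-mono G (q⊆p∪q ⁅ d ⁆ S) x∈N[S]) , x∉N[d])

averageSubcover : (G : Graph n) (g : ℕ) (D X : Subset n) → ∣ D ∣ ≤ g → X ⊆ N[ D ] G →
  ∀ k → k ≤ g → ∃[ S ] ∣ S ∣ ≤ k × k * ∣ X ∣ ≤ g * ∣ X ∩ N[ S ] G ∣
averageSubcover {n} G g D X _ _ zero _ = ∅ , ∣∅∣≤m {n} 0 , z≤n
averageSubcover G (suc g) D X ∣D∣≤ X⊆N[D] (suc k) k≤ with ∣ D ∣ ≤? suc k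
... | yes ∣D∣≤k = D , ∣D∣≤k , *-mono-≤ k≤ (p⊆q⇒∣p∣≤∣q∣ λ x∈X → x∈p∩q⁺ (x∈X , X⊆N[D] x∈X))
... | no ∣D∣≰k = removing (0<∣p∣⇒Nonempty D (≤-<-trans z≤n k<∣D∣))
  where
  k<∣D∣ = ≰⇒> ∣D∣≰k
  k<g : suc k ≤ g
  k<g = s≤s⁻¹ (≤-trans k<∣D∣ ∣D∣≤)
  instance
    g≢0 : NonZero g
    g≢0 = >-nonZero (≤-trans (s≤s z≤n) k<g)

  removing : Nonempty D → ∃[ S ] ∣ S ∣ ≤ suc k × suc k * ∣ X ∣ ≤ suc g * ∣ X ∩ N[ S ] G ∣
  removing (d , d∈D) = choose (g * w ≤? t)
    where
    N[d] = N[ ⁅ d ⁆ ] G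
    X′ = X ∩ ∁ N[d]
    w = ∣ X ∩ N[d] ∣
    t = ∣ X′ ∣
    ∣X∣≡w+t : ∣ X ∣ ≡ w + t
    ∣X∣≡w+t = ∣p∣≡∣p∩q∣+∣p∩∁q∣ X N[d]
    ∣D-d∣≤g : ∣ D - d ∣ ≤ g
    ∣D-d∣≤g = s≤s⁻¹ (≤-trans (x∈p⇒∣p-x∣<∣p∣ d∈D) ∣D∣≤)
    recurse : ∀ k → k ≤ g → ∃[ S ] ∣ S ∣ ≤ k × k * t ≤ g * ∣ X′ ∩ N[ S ] G ∣
    recurse = averageSubcover G g (D - d) X′ ∣D-d∣≤g (X∩∁N[⁅d⁆]⊆N[D-d] G D d X⊆N[D])

    choose : Dec (g * w ≤ t) → ∃[ S ] ∣ S ∣ ≤ suc k × suc k * ∣ X ∣ ≤ suc g * ∣ X ∩ N[ S ] G ∣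
    choose (yes gw≤t) with recurse (suc k) k<g
    ... | S , ∣S∣≤k , kt≤gc = S , ∣S∣≤k , (begin
      suc k * ∣ X ∣          ≡⟨ cong (suc k *_) ∣X∣≡w+t ⟩
      suc k * (w + t)        ≤⟨ skip-≤ (suc k) w t _ gw≤t kt≤gc ⟩
      suc g * ∣ X′ ∩ N[ S ] G ∣ ≤⟨ *-monoʳ-≤ (suc g) (p⊆q⇒∣p∣≤∣q∣ (∩-mono-⊆ (p∩q⊆p X _) id)) ⟩
      suc g * ∣ X ∩ N[ S ] G ∣  ∎)
      where open ≤-Reasoning
    choose (no gw≰t) with recurse k (≤-trans (n≤1+n k) k<g)
    ... | S′ , ∣S′∣≤k , kt≤gc = ⁅ d ⁆ ∪ S′ , ≤-trans (∣⁅x⁆∪p∣≤1+∣p∣ d S′) (s≤s ∣S′∣≤k) , (begin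
      suc k * ∣ X ∣             ≡⟨ cong (suc k *_) ∣X∣≡w+t ⟩
      suc k * (w + t)           ≤⟨ take-≤ w t _ (≤-trans (n≤1+n k) k<g) (<⇒≤ (≰⇒> gw≰t)) kt≤gc ⟩
      suc g * (w + ∣ X′ ∩ N[ S′ ] G ∣) ≤⟨ *-monoʳ-≤ (suc g) (∣X∩N[d]∣+∣X-N[d]∩N[S]∣≤∣X∩N[d∪S]∣ G X S′ d) ⟩
      suc g * ∣ X ∩ N[ ⁅ d ⁆ ∪ S′ ] G ∣ ∎)
      where open ≤-Reasoning

fractionalDominating : (G : Graph n) (i j : ℕ) (D : Subset n) → i ≤ suc j → Dominating G D →
  ∃[ S ] ∣ S ∣ ≤ ceilDiv (i * ∣ D ∣) (suc j) × IsDominating G i (suc j) S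
fractionalDominating {zero} G i j D _ _ = ∅ , z≤n , ≤-trans (≤-reflexive (*-zeroʳ i)) z≤n
fractionalDominating {suc n} G i j D i≤j D-dom =
  let S , ∣S∣≤k , kn≤gc = averageSubcover G ∣ D ∣ D V ≤-refl (λ _ → D-dom _) k k≤∣D∣
  in S , ∣S∣≤k ,
     cross-≤-trans {i} {suc j} {k} {∣ D ∣} {suc n} {{∣D∣≢0}} (≤-*-ceilDiv (i * ∣ D ∣) j) (shareOfAll S kn≤gc)
  where
  V : Subset (suc n)
  V = Full
  k = ceilDiv (i * ∣ D ∣) (suc j)
  k≤∣D∣ : k ≤ ∣ D ∣
  k≤∣D∣ = ceilDiv-≤ (i * ∣ D ∣) j _ (*-monoˡ-≤ ∣ D ∣ i≤j)
  ∣D∣≢0 : NonZero ∣ D ∣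
  ∣D∣≢0 with ∈N[]⁻ G D (D-dom zero)
  ... | _ , u∈D , _ = >-nonZero (x∈p⇒0<∣p∣ u∈D)
  shareOfAll : ∀ S → k * ∣ V ∣ ≤ ∣ D ∣ * ∣ V ∩ N[ S ] G ∣ → k * suc n ≤ ∣ D ∣ * ∣ N[ S ] G ∣
  shareOfAll S kn≤gc = begin
    k * suc n                ≡⟨ cong (k *_) (∣⊤∣≡n (suc n)) ⟨
    k * ∣ V ∣                ≤⟨ kn≤gc ⟩
    ∣ D ∣ * ∣ V ∩ N[ S ] G ∣ ≤⟨ *-monoʳ-≤ ∣ D ∣ (∣p∩q∣≤∣q∣ V (N[ S ] G)) ⟩
    ∣ D ∣ * ∣ N[ S ] G ∣     ∎
    where open ≤-Reasoning

-- Ore's bound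

MinimalDominating : Graph n → Subset n → Set
MinimalDominating G D = Dominating G D × (∀ {x} → x ∈ D → ¬ Dominating G (D - x))

∃minimalDominating : (G : Graph n) → ∃[ D ] MinimalDominating G D
∃minimalDominating G = shrink Full (<-wellFounded _) (Full-dominating G)
  where
  shrink : ∀ D → Acc _<_ ∣ D ∣ → Dominating G D → ∃[ D′ ] MinimalDominating G D′
  shrink D (acc smaller) D-dom with any? (λ x → x ∈? D ×-dec dominating? G (D - x))
  ... | yes (x , x∈D , D-x-dom) = shrink (D - x) (smaller (x∈p⇒∣p-x∣<∣p∣ x∈D)) D-x-dom
  ... | no irremovable = D , D-dom , λ x∈D D-x-dom → irremovable (_ , x∈D , D-x-dom)

NoIsolatedVertex : Graph n → Set
NoIsolatedVertex G = ∀ v → ∃[ u ] Adj G v u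

∉N[D-v]⇒∈∁D : (G : Graph n) (D : Subset n) {v y z : Fin n} →
  y ∉ N[ D - v ] G → Adj G v z → Dominates G z y → z ∈ ∁ D
∉N[D-v]⇒∈∁D G D y∉ vz z→y =
  x∉p⇒x∈∁p λ z∈D → y∉ (∈N[]⁺ G (D - _) (x∈p∧x≢y⇒x∈p-y z∈D (≢-sym (Adj⇒≢ G vz))) z→y)

-- Minimality yields a vertex y that no vertex of D other than v dominates; then y, or a
-- neighbour of v if y = v, lies outside D and is adjacent to v.

∁-dominating : (G : Graph n) → NoIsolatedVertex G → ∀ {D} → MinimalDominating G D → Dominating G (∁ D)
∁-dominating G noIsolated {D} (D-dom , minimal) v with v ∈? D
... | no v∉D = ∈N[]⁺ G (∁ D) (x∉p⇒x∈∁p v∉D) (inj₁ refl)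
... | yes v∈D with ¬∀⟶∃¬ _ _ (λ y → y ∈? N[ D - v ] G) (minimal v∈D)
...   | y , y∉N[D-v] with ∈N[]⁻ G D (D-dom y)
...     | u , u∈D , u→y with u ≟ v
...       | no u≢v = contradiction (∈N[]⁺ G (D - v) (x∈p∧x≢y⇒x∈p-y u∈D u≢v) u→y) y∉N[D-v]
...       | yes refl with u→y
...         | inj₁ refl = let z , uz = noIsolated u in
  ∈N[]⁺ G (∁ D) (∉N[D-v]⇒∈∁D G D y∉N[D-v] uz (inj₂ (Adj-sym G uz))) (inj₂ (Adj-sym G uz))
...         | inj₂ uy = ∈N[]⁺ G (∁ D) (∉N[D-v]⇒∈∁D G D y∉N[D-v] uy (inj₁ refl)) (inj₂ (Adj-sym G uy))

ore : (G : Graph n) → NoIsolatedVertex G → ∃[ D ] Dominating G D × ∣ D ∣ ≤ ⌊ n /2⌋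
ore G noIsolated with ∃minimalDominating G
... | D , minimal with m+n≡o⇒m≤⌊o/2⌋⊎n≤⌊o/2⌋ (∣p∣+∣∁p∣≡n D)
...   | inj₁ ∣D∣≤ = D , proj₁ minimal , ∣D∣≤
...   | inj₂ ∣∁D∣≤ = ∁ D , ∁-dominating G noIsolated minimal , ∣∁D∣≤

walk⇒Adj : {G : Graph n} {u v : Fin n} → Walk G u v → u ≢ v → ∃[ w ] Adj G u w
walk⇒Adj here u≢u = contradiction refl u≢u
walk⇒Adj (step uw _) _ = _ , from T-≡ uw

connected⇒noIsolatedVertex : (G : Graph (suc (suc n))) → Connected G → NoIsolatedVertex G
connected⇒noIsolatedVertex G conn zero = walk⇒Adj (conn zero (suc zero)) λ ()
connected⇒noIsolatedVertex G conn (suc v) = walk⇒Adj (conn (suc v) zero) λ ()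

-- Common neighbours and pair covers

CommonNeighbours : Graph n → Set
CommonNeighbours H = ∀ x y → ∃[ w ] Adj H x w × Adj H y w

noDominatingPair⇒commonNeighbours : (H H′ : Graph n) → (∀ {u v} → ¬ Dominates H u v → Adj H′ u v) →
  ¬ (∃[ D ] Dominating H D × ∣ D ∣ ≤ 2) → CommonNeighbours H′
noDominatingPair⇒commonNeighbours H H′ ¬dom⇒adj noPair x y =
  let w , w∉N[P] = ¬∀⟶∃¬ _ _ (λ w → w ∈? N[ P ] H) (λ P-dom → noPair (P , P-dom , ∣P∣≤2))
  in w , ¬dom⇒adj (w∉N[P] ∘ ∈N[]⁺ H P (x∈p∪q⁺ (inj₁ (x∈⁅x⁆ x))))
       , ¬dom⇒adj (w∉N[P] ∘ ∈N[]⁺ H P (x∈p∪q⁺ (inj₂ (x∈⁅x⁆ y))))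
  where
  P = ⁅ x ⁆ ∪ ⁅ y ⁆
  ∣P∣≤2 : ∣ P ∣ ≤ 2
  ∣P∣≤2 = ≤-trans (∣p∪q∣≤∣p∣+∣q∣ ⁅ x ⁆ ⁅ y ⁆) (≤-reflexive (cong₂ _+_ (∣⁅x⁆∣≡1 x) (∣⁅x⁆∣≡1 y)))

pairCover : (H : Graph n) → CommonNeighbours H → ∀ k (R : Subset n) → ∣ R ∣ ≤ k + k →
  ∃[ P ] ∣ P ∣ ≤ k × R ⊆ N[ P ] H
pairCover {n} H common zero R ∣R∣≤0 =
  ∅ , ∣∅∣≤m {n} 0 , λ x∈R → contradiction (x∈p⇒0<∣p∣ x∈R) (≤⇒≯ ∣R∣≤0)
pairCover {n} H common (suc k) R ∣R∣≤ = byFirst (nonempty? R)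
  where
  byFirst : Dec (Nonempty R) → ∃[ P ] ∣ P ∣ ≤ suc k × R ⊆ N[ P ] H
  bySecond : ∀ {x} → x ∈ R → Dec (Nonempty (R - x)) → ∃[ P ] ∣ P ∣ ≤ suc k × R ⊆ N[ P ] H
  addPair : ∀ {x y} → x ∈ R → y ∈ R - x → ∃[ w ] Adj H x w × Adj H y w → ∃[ P ] ∣ P ∣ ≤ suc k × R ⊆ N[ P ] H

  byFirst (no R-empty) = ∅ , ∣∅∣≤m {n} (suc k) , λ x∈R → contradiction (_ , x∈R) R-empty
  byFirst (yes (x , x∈R)) = bySecond x∈R (nonempty? (R - x))

  bySecond {x} x∈R (no R-x-empty) =
    ⁅ x ⁆ , ≤-trans (≤-reflexive (∣⁅x⁆∣≡1 x)) (s≤s z≤n) ,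
    λ z∈R → ∈N[]⁺ H ⁅ x ⁆ (x∈⁅x⁆ x) (inj₁ (sym (Empty[p-x]∧y∈p⇒y≡x R-x-empty z∈R)))
  bySecond x∈R (yes (y , y∈R-x)) = addPair x∈R y∈R-x (common _ y)

  addPair {x} {y} x∈R y∈R-x (w , xw , yw) =
    let P , ∣P∣≤k , R-x-y⊆N[P] = pairCover H common k (R - x - y) ∣R-x-y∣≤
    in ⁅ w ⁆ ∪ P ,
       ≤-trans (∣⁅x⁆∪p∣≤1+∣p∣ w P) (s≤s ∣P∣≤k) ,
       cover P R-x-y⊆N[P]
    where
    ∣R-x-y∣≤ : ∣ R - x - y ∣ ≤ k + k
    ∣R-x-y∣≤ = s≤s⁻¹ (s≤s⁻¹ (begin
      suc (suc ∣ R - x - y ∣) ≤⟨ s≤s (x∈p⇒∣p-x∣<∣p∣ y∈R-x) ⟩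
      suc ∣ R - x ∣           ≤⟨ x∈p⇒∣p-x∣<∣p∣ x∈R ⟩
      ∣ R ∣                   ≤⟨ ∣R∣≤ ⟩
      suc k + suc k           ≡⟨ cong suc (+-suc k k) ⟩
      suc (suc (k + k))       ∎))
      where open ≤-Reasoning
    cover : ∀ P → R - x - y ⊆ N[ P ] H → R ⊆ N[ ⁅ w ⁆ ∪ P ] H
    cover P R-x-y⊆N[P] {z} z∈R with z ≟ x | z ≟ y
    ... | yes refl | _ = ∈N[]⁺ H (⁅ w ⁆ ∪ P) (x∈p∪q⁺ (inj₁ (x∈⁅x⁆ w))) (inj₂ (Adj-sym H xw))
    ... | no _ | yes refl = ∈N[]⁺ H (⁅ w ⁆ ∪ P) (x∈p∪q⁺ (inj₁ (x∈⁅x⁆ w))) (inj₂ (Adj-sym H yw))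
    ... | no z≢x | no z≢y =
      N[]-mono H (q⊆p∪q ⁅ w ⁆ P) (R-x-y⊆N[P] (x∈p∧x≢y⇒x∈p-y (x∈p∧x≢y⇒x∈p-y z∈R z≢x) z≢y))

-- Parity of degrees

neighbours : Graph n → Fin n → Subset n
neighbours G v = tabulate (adj G v)

degree : Graph n → Fin n → ℕ
degree G v = ∣ neighbours G v ∣

bit : Bool → Parity
bit false = 0ℙ
bit true = 1ℙ

parity-suc : ∀ m → parity (suc m) ≡ parity m ℙ.⁻¹
parity-suc m = trans (sym (ℙ.⁻¹-involutive _)) (cong ℙ._⁻¹ (ℙ.suc-homo-⁻¹ m))

parity∣tabulate∣ : ∀ (f : Fin n → Bool) → parity ∣ tabulate f ∣ ≡ ∑[ u < n ] bit (f u)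
parity∣tabulate∣ {zero} f = refl
parity∣tabulate∣ {suc n} f with f zero
... | false = parity∣tabulate∣ (f ∘ suc)
... | true = trans (parity-suc ∣ tabulate (f ∘ suc) ∣) (cong ℙ._⁻¹ (parity∣tabulate∣ (f ∘ suc)))

∑∑-symmetric≡0ℙ : ∀ (a : Fin n → Fin n → Parity) → (∀ u v → a u v ≡ a v u) → (∀ v → a v v ≡ 0ℙ) →
  ∑[ u < n ] ∑[ v < n ] a u v ≡ 0ℙ
∑∑-symmetric≡0ℙ {zero} a _ _ = refl
∑∑-symmetric≡0ℙ {suc n} a a-sym a-diag = begin
  (a zero zero ℙ.+ r) ℙ.+ ∑[ u < n ] (a (suc u) zero ℙ.+ ∑[ v < n ] a (suc u) (suc v))
    ≡⟨ cong₂ ℙ._+_ (cong (ℙ._+ r) (a-diag zero))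
                   (∑-distrib-+ (λ u → a (suc u) zero) (λ u → ∑[ v < n ] a (suc u) (suc v))) ⟩
  r ℙ.+ (∑[ u < n ] a (suc u) zero ℙ.+ T′)
    ≡⟨ cong (λ c → r ℙ.+ (c ℙ.+ T′)) (sum-cong-≗ λ u → a-sym (suc u) zero) ⟩
  r ℙ.+ (r ℙ.+ T′)   ≡⟨ ℙ.+-assoc r r T′ ⟨
  (r ℙ.+ r) ℙ.+ T′   ≡⟨ cong (ℙ._+ T′) (ℙ.p+p≡0ℙ r) ⟩
  T′
    ≡⟨ ∑∑-symmetric≡0ℙ (λ u v → a (suc u) (suc v)) (λ u v → a-sym (suc u) (suc v)) (a-diag ∘ suc) ⟩
  0ℙ                 ∎
  where
  open ≡-Reasoning
  r = ∑[ v < n ] a zero (suc v)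
  T′ = ∑[ u < n ] ∑[ v < n ] a (suc u) (suc v)

handshake : (G : Graph n) → ∑[ v < n ] parity (degree G v) ≡ 0ℙ
handshake G = trans (sum-cong-≗ λ v → parity∣tabulate∣ (adj G v))
  (∑∑-symmetric≡0ℙ (λ u v → bit (adj G u v))
                   (λ u v → cong bit (Graph.sym G u v)) (λ v → cong bit (irrefl G v)))

∑1ℙ≡parity : ∀ n → ∑[ v < n ] 1ℙ ≡ parity n
∑1ℙ≡parity zero = refl
∑1ℙ≡parity (suc n) = trans (cong ℙ._⁻¹ (∑1ℙ≡parity n)) (sym (parity-suc n))

oddOrder⇒evenDegree : (G : Graph n) → parity n ≡ 1ℙ → ∃[ v ] parity (degree G v) ≡ 0ℙ
oddOrder⇒evenDegree {n} G odd with any? (λ v → parity (degree G v) ℙ.≟ 0ℙ)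
... | yes even = even
... | no noneEven = contradiction (begin
  0ℙ                            ≡⟨ handshake G ⟨
  ∑[ v < n ] parity (degree G v) ≡⟨ sum-cong-≗ allOdd ⟩
  ∑[ v < n ] 1ℙ                 ≡⟨ ∑1ℙ≡parity n ⟩
  parity n                      ≡⟨ odd ⟩
  1ℙ                            ∎) λ ()
  where
  open ≡-Reasoning
  allOdd : ∀ v → parity (degree G v) ≡ 1ℙ
  allOdd v with parity (degree G v) in eq
  ... | 0ℙ = contradiction (v , eq) noneEven
  ... | 1ℙ = refl

parity[1+m+n]≡0ℙ⇒even : ∀ m k → parity (suc (m + k)) ≡ 0ℙ → parity m ≡ 0ℙ ⊎ parity k ≡ 0ℙ
parity[1+m+n]≡0ℙ⇒even m k even = oneEven (parity m) (parity k) (begin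
  parity m ℙ.+ parity k   ≡⟨ ℙ.+-homo-+ m k ⟨
  parity (m + k)          ≡⟨ ℙ.suc-homo-⁻¹ (m + k) ⟨
  parity (suc (m + k)) ℙ.⁻¹ ≡⟨ cong ℙ._⁻¹ even ⟩
  1ℙ                      ∎)
  where
  open ≡-Reasoning
  oneEven : ∀ p q → p ℙ.+ q ≡ 1ℙ → p ≡ 0ℙ ⊎ q ≡ 0ℙ
  oneEven 0ℙ _ _ = inj₁ refl
  oneEven 1ℙ 0ℙ _ = inj₂ refl

-- The Nordhaus–Gaddum bound for domination

nonNeighbours : Graph n → Fin n → Subset n
nonNeighbours G v = ∁ (⁅ v ⁆ ∪ neighbours G v)

∣⁅v⁆∪neighbours∣≡1+degree : (G : Graph n) (v : Fin n) → ∣ ⁅ v ⁆ ∪ neighbours G v ∣ ≡ suc (degree G v)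
∣⁅v⁆∪neighbours∣≡1+degree G v = begin
  ∣ ⁅ v ⁆ ∪ neighbours G v ∣                                ≡⟨ +-identityʳ _ ⟨
  ∣ ⁅ v ⁆ ∪ neighbours G v ∣ + 0                            ≡⟨ cong (∣ ⁅ v ⁆ ∪ neighbours G v ∣ +_) (Empty⇒∣p∣≡0 v∉neighbours) ⟨
  ∣ ⁅ v ⁆ ∪ neighbours G v ∣ + ∣ ⁅ v ⁆ ∩ neighbours G v ∣  ≡⟨ ∣p∪q∣+∣p∩q∣≡∣p∣+∣q∣ ⁅ v ⁆ (neighbours G v) ⟩
  ∣ ⁅ v ⁆ ∣ + degree G v                                    ≡⟨ cong (_+ degree G v) (∣⁅x⁆∣≡1 v) ⟩
  suc (degree G v)                                          ∎
  where
  open ≡-Reasoning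
  v∉neighbours : Empty (⁅ v ⁆ ∩ neighbours G v)
  v∉neighbours (u , u∈) with x∈p∩q⁻ ⁅ v ⁆ (neighbours G v) u∈
  ... | u∈⁅v⁆ , u∈N with x∈⁅y⁆⇒x≡y v u∈⁅v⁆
  ...   | refl = Adj⇒≢ G (∈tabulate⁻ (adj G u) u∈N) refl

1+degree+∣nonNeighbours∣≡n : (G : Graph n) (v : Fin n) → suc (degree G v + ∣ nonNeighbours G v ∣) ≡ n
1+degree+∣nonNeighbours∣≡n G v =
  trans (cong (_+ ∣ nonNeighbours G v ∣) (sym (∣⁅v⁆∪neighbours∣≡1+degree G v)))
        (∣p∣+∣∁p∣≡n (⁅ v ⁆ ∪ neighbours G v))

evenSideVertex : (G : Graph (suc n)) →
  ∃[ v ] (parity (degree G v) ≡ 0ℙ ⊎ parity ∣ nonNeighbours G v ∣ ≡ 0ℙ)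
evenSideVertex {n} G with parity (suc n) in order-parity
... | 1ℙ = let v , even = oddOrder⇒evenDegree G order-parity in v , inj₁ even
... | 0ℙ = zero , parity[1+m+n]≡0ℙ⇒even (degree G zero) ∣ nonNeighbours G zero ∣
                   (trans (cong parity (1+degree+∣nonNeighbours∣≡n G zero)) order-parity)

anchoredPairCover : (H : Graph n) → CommonNeighbours H → (v : Fin n) (Y : Subset n) →
  (∀ {u} → u ∉ Y → Dominates H v u) → ∃[ D ] Dominating H D × ∣ D ∣ ≤ suc ⌈ ∣ Y ∣ /2⌉
anchoredPairCover H common v Y v-dominates-rest =
  let P , ∣P∣≤ , Y⊆N[P] = pairCover H common ⌈ ∣ Y ∣ /2⌉ Y (m≤⌈m/2⌉+⌈m/2⌉ ∣ Y ∣)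
  in ⁅ v ⁆ ∪ P , dominating P Y⊆N[P] ,
     ≤-trans (∣⁅x⁆∪p∣≤1+∣p∣ v P) (s≤s ∣P∣≤)
  where
  m≤⌈m/2⌉+⌈m/2⌉ : ∀ m → m ≤ ⌈ m /2⌉ + ⌈ m /2⌉
  m≤⌈m/2⌉+⌈m/2⌉ m = ≤-trans (≤-reflexive (sym (⌊n/2⌋+⌈n/2⌉≡n m))) (+-monoˡ-≤ ⌈ m /2⌉ (⌊n/2⌋≤⌈n/2⌉ m))
  dominating : ∀ P → Y ⊆ N[ P ] H → Dominating H (⁅ v ⁆ ∪ P)
  dominating P Y⊆N[P] u with u ∈? Y
  ... | yes u∈Y = N[]-mono H (q⊆p∪q ⁅ v ⁆ P) (Y⊆N[P] u∈Y)
  ... | no u∉Y = ∈N[]⁺ H (⁅ v ⁆ ∪ P) (x∈p∪q⁺ (inj₁ (x∈⁅x⁆ v))) (v-dominates-rest u∉Y)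

commonNeighbours⇒bound : (G : Graph n) → CommonNeighbours G → CommonNeighbours (complement G) →
  (v : Fin n) → parity (degree G v) ≡ 0ℙ ⊎ parity ∣ nonNeighbours G v ∣ ≡ 0ℙ →
  ∃[ D ] ∃[ E ] Dominating G D × Dominating (complement G) E × ∣ D ∣ + ∣ E ∣ ≤ ⌊ n /2⌋ + 2
commonNeighbours⇒bound {n} G commonG commonḠ v evenSide =
  let D , D-dom , ∣D∣≤ = anchoredPairCover G commonG v (nonNeighbours G v) v-dominates-neighbours
      E , E-dom , ∣E∣≤ = anchoredPairCover (complement G) commonḠ v (neighbours G v) v-dominates-nonNeighbours
  in D , E , D-dom , E-dom , (begin
    ∣ D ∣ + ∣ E ∣                 ≤⟨ +-mono-≤ ∣D∣≤ ∣E∣≤ ⟩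
    suc ⌈ r /2⌉ + suc ⌈ d /2⌉     ≡⟨ cong suc (+-suc ⌈ r /2⌉ ⌈ d /2⌉) ⟩
    suc (suc (⌈ r /2⌉ + ⌈ d /2⌉)) ≡⟨ +-comm 2 _ ⟩
    ⌈ r /2⌉ + ⌈ d /2⌉ + 2         ≡⟨ cong (_+ 2) (⌈m/2⌉+⌈n/2⌉≡⌈m+n/2⌉ r d (swap evenSide)) ⟩
    ⌈ r + d /2⌉ + 2               ≡⟨ cong (λ m → ⌊ suc m /2⌋ + 2) (+-comm r d) ⟩
    ⌊ suc (d + r) /2⌋ + 2         ≡⟨ cong (λ m → ⌊ m /2⌋ + 2) (1+degree+∣nonNeighbours∣≡n G v) ⟩
    ⌊ n /2⌋ + 2                   ∎)
  where
  open ≤-Reasoning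
  d = degree G v
  r = ∣ nonNeighbours G v ∣
  v-dominates-neighbours : ∀ {u} → u ∉ nonNeighbours G v → Dominates G v u
  v-dominates-neighbours u∉ with x∈p∪q⁻ ⁅ v ⁆ (neighbours G v) (x∉∁p⇒x∈p u∉)
  ... | inj₁ u∈⁅v⁆ = inj₁ (sym (x∈⁅y⁆⇒x≡y v u∈⁅v⁆))
  ... | inj₂ u∈N = inj₂ (∈tabulate⁻ (adj G v) u∈N)
  v-dominates-nonNeighbours : ∀ {u} → u ∉ neighbours G v → Dominates (complement G) v u
  v-dominates-nonNeighbours u∉N = ¬Adj⇒Dominates-complement G (u∉N ∘ ∈tabulate⁺ (adj G v))

nordhausGaddum : (G : Graph n) → Connected G → Connected (complement G) →
  ∃[ D ] ∃[ E ] Dominating G D × Dominating (complement G) E × ∣ D ∣ + ∣ E ∣ ≤ ⌊ n /2⌋ + 2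
nordhausGaddum {zero} G _ _ = Full , Full , Full-dominating G , Full-dominating (complement G) , z≤n
nordhausGaddum {suc zero} G _ _ = Full , Full , Full-dominating G , Full-dominating (complement G) , ≤-refl
nordhausGaddum {suc (suc n)} G conn connᶜ
  with anySubset? (λ E → dominating? (complement G) E ×-dec ∣ E ∣ ≤? 2)
... | yes (E , E-dom , ∣E∣≤2) =
  let D , D-dom , ∣D∣≤ = ore G (connected⇒noIsolatedVertex G conn)
  in D , E , D-dom , E-dom , +-mono-≤ ∣D∣≤ ∣E∣≤2
... | no noPairᶜ with anySubset? (λ D → dominating? G D ×-dec ∣ D ∣ ≤? 2)
...   | yes (D , D-dom , ∣D∣≤2) =
  let E , E-dom , ∣E∣≤ = ore (complement G) (connected⇒noIsolatedVertex (complement G) connᶜ)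
  in D , E , D-dom , E-dom , ≤-trans (+-mono-≤ ∣D∣≤2 ∣E∣≤) (≤-reflexive (+-comm 2 _))
...   | no noPair =
  let v , evenSide = evenSideVertex G
  in commonNeighbours⇒bound G
       (noDominatingPair⇒commonNeighbours (complement G) G (¬Dominates-complement⇒Adj G) noPairᶜ)
       (noDominatingPair⇒commonNeighbours G (complement G) (¬Dominates⇒Adj-complement G) noPair)
       v evenSide

theorem3p5 : (i j' n : ℕ) → i ≤ suc j' → (G : Graph n) → Connected G → Connected (complement G) → (a b : ℕ) → IsGamma G i (suc j') a → IsGamma (complement G) i (suc j') b → a + b ≤ ceilDiv (i * ((n / 2) + 2)) (suc j') + 1
theorem3p5 i j n i≤j G conn connᶜ a b (_ , a-min) (_ , b-min) =
  let D , E , D-dom , E-dom , ∣D∣+∣E∣≤ = nordhausGaddum G conn connᶜ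
      S , ∣S∣≤ , S-dom = fractionalDominating G i j D i≤j D-dom
      T , ∣T∣≤ , T-dom = fractionalDominating (complement G) i j E i≤j E-dom
  in begin
    a + b
      ≤⟨ +-mono-≤ (≤-trans (a-min S S-dom) ∣S∣≤) (≤-trans (b-min T T-dom) ∣T∣≤) ⟩
    ceilDiv (i * ∣ D ∣) (suc j) + ceilDiv (i * ∣ E ∣) (suc j)
      ≤⟨ ceilDiv-+-≤ (i * ∣ D ∣) (i * ∣ E ∣) j ⟩
    ceilDiv (i * ∣ D ∣ + i * ∣ E ∣) (suc j) + 1
      ≡⟨ cong (λ x → ceilDiv x (suc j) + 1) (*-distribˡ-+ i ∣ D ∣ ∣ E ∣) ⟨
    ceilDiv (i * (∣ D ∣ + ∣ E ∣)) (suc j) + 1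
      ≤⟨ +-monoˡ-≤ 1 (ceilDiv-mono-≤ j (*-monoʳ-≤ i ∣D∣+∣E∣≤)) ⟩
    ceilDiv (i * (⌊ n /2⌋ + 2)) (suc j) + 1
      ≡⟨ cong (λ m → ceilDiv (i * (m + 2)) (suc j) + 1) (⌊n/2⌋≡n/2 n) ⟩
    ceilDiv (i * (n / 2 + 2)) (suc j) + 1
      ∎
  where open ≤-Reasoning
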